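{- Let $\Gamma_n$ be the Sierpiński graph with the "Schreier" labeling. Let $c_n$ be the number of $c$-labeled edges of a uniformly random dimer covering of $\Gamma_n$, with mean $\mu_n$ and standard deviation $\sigma_n$, and let $C_n=(c_n-\mu_n)/\sigma_n$. - For $n$ odd, $C_n$ equals $\sqrt3$ on every covering of type $h^{ab}$, and equals $-\frac1{\sqrt3}$ on every covering of type $f$, $h^{ac}$ or $h^{bc}$. - For $n$ even, $C_n$ equals $-\sqrt3$ on every covering of type $g^{ab}$, and equals $\frac1{\sqrt3}$ on every covering of type $t$, $g^{ac}$ or $g^{bc}$.
   Context: Let $a,b,c$ act on ternary words by the recursive rules, valid for any ternary word $w$: - $a(0w)=1w$, $a(1w)=0w$, $a(2w)=2a(w)$; - $b(0w)=2w$, $b(2w)=0w$, $b(1w)=1b(w)$; - $c(1w)=2w$, $c(2w)=1w$, $c(0w)=0c(w)$. Let $\Sigma_n$ be the loopless graph on $\{0,1,2\}^n$ with one edge labeled $s$ for each unordered pair $\{u,s(u)\}$, $s(u)\ne u$. The elementary triangles are, for $w\in\{0,1,2\}^{n-1}$, the vertices $0w,1w,2w$ with edges $0w$–$1w$ (label $a$), $0w$–$2w$ (label $b$), and $1w$–$2w$ (label $c$). $\Gamma_n$ is obtained from $\Sigma_n$ by contracting all edges not in an elementary triangle, keeping labels. Its corners are: - $0^n$, where an $a$-edge and a $b$-edge meet; - $1^n$, where an $a$-edge and a $c$-edge meet; - $2^n$, where a $b$-edge and a $c$-edge meet. A dimer covering of $\Gamma_n$ is a matching covering every non-corner vertex,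 and - for $n$ odd, covering exactly $0$ or $2$ corners; - for $n$ even, covering exactly $1$ or $3$ corners. A covering is of type: - $f$ if it covers no corner; - $g^{ab}$, $g^{ac}$, $g^{bc}$ if it covers exactly the corner $0^n$, $1^n$, $2^n$ respectively; - $h^{ab}$, $h^{ac}$, $h^{bc}$ if it covers exactly two corners and misses $0^n$, $1^n$, $2^n$ respectively; - $t$ if it covers all three corners. The mean and variance of $c_n$ are $\mu_n=3^{n-1}/4$ and $\sigma_n^2=3/16$. -}

module Defs where

open import Data.Nat using (ℕ; zero; suc; _^_; _∸_)
open import Data.Vec using (Vec; []; _∷_; replicate)
open import Data.List using (List; []; _∷_; _++_; map; concatMap; length; filter)
open import Data.Product using (Σ; ∃; _×_; _,_)
open import Data.Sum using (_⊎_)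
open import Data.Bool using (Bool; true; false; T; T?)
open import Data.Integer using (+_)
open import Data.Rational using (ℚ; _/_; _-_; _*_; _<_; 0ℚ)
open import Relation.Nullary using (¬_)
open import Relation.Binary.PropositionalEquality using (_≡_; _≢_)
open import Relation.Binary.Construct.Closure.Equivalence using (EqClosure)

data Letter : Set where
  l0 l1 l2 : Letter

Word : ℕ → Set
Word n = Vec Letter n

data Gen : Set where
  ga gb gc : Gen

act : Gen → ∀ {n} → Word n → Word n
act s [] = []
act ga (l0 ∷ w) = l1 ∷ w
act ga (l1 ∷ w) = l0 ∷ w
act ga (l2 ∷ w) = l2 ∷ act ga w
act gb (l0 ∷ w) = l2 ∷ w
act gb (l2 ∷ w) = l0 ∷ w
act gb (l1 ∷ w) = l1 ∷ act gb w
act gc (l1 ∷ w) = l2 ∷ w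
act gc (l2 ∷ w) = l1 ∷ w
act gc (l0 ∷ w) = l0 ∷ act gc w

-- Edges of the elementary triangles, indexed by (w , label), w ∈ {0,1,2}^(n-1):
-- label a : 0w – 1w,  label b : 0w – 2w,  label c : 1w – 2w.
ElemEdge : ℕ → Set
ElemEdge m = Word m × Gen

end₁ end₂ : ∀ {m} → ElemEdge m → Word (suc m)
end₁ (w , ga) = l0 ∷ w
end₁ (w , gb) = l0 ∷ w
end₁ (w , gc) = l1 ∷ w
end₂ (w , ga) = l1 ∷ w
end₂ (w , gb) = l2 ∷ w
end₂ (w , gc) = l2 ∷ w

InElemTriangle : ∀ {m} → Gen → Word (suc m) → Word (suc m) → Set
InElemTriangle {m} s u v =
  Σ (Word m) λ w → ((end₁ (w , s) ≡ u) × (end₂ (w , s) ≡ v))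
                 ⊎ ((end₁ (w , s) ≡ v) × (end₂ (w , s) ≡ u))

-- u and v are joined in Σ_(suc m) by an edge (labelled s) NOT in an
-- elementary triangle; these are the edges that get contracted.
Contracted : ∀ {m} → Word (suc m) → Word (suc m) → Set
Contracted u v = Σ Gen λ s → (act s u ≡ v) × (u ≢ v) × ¬ InElemTriangle s u v

_∼_ : ∀ {m} → Word (suc m) → Word (suc m) → Set
_∼_ = EqClosure Contracted

-- A set of edges of Γ_(suc m) (edges of Γ are exactly the elementary-triangle edges)
EdgeSet : ℕ → Set
EdgeSet m = ElemEdge m → Bool

IsEndpoint : ∀ {m} → Word (suc m) → ElemEdge m → Set
IsEndpoint x e = (x ≡ end₁ e) ⊎ (x ≡ end₂ e)

Covered : ∀ {m} → EdgeSet m → Word (suc m) → Set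
Covered {m} D v = Σ (ElemEdge m) λ e → T (D e) × Σ (Word (suc m)) λ x → IsEndpoint x e × (x ∼ v)

IsMatching : ∀ {m} → EdgeSet m → Set
IsMatching {m} D =
  (∀ e → T (D e) → ¬ (end₁ e ∼ end₂ e)) ×
  (∀ e e' → T (D e) → T (D e') → e ≢ e' →
     ∀ x y → IsEndpoint x e → IsEndpoint y e' → ¬ (x ∼ y))

corner : ∀ {m} → Letter → Word (suc m)
corner {m} l = replicate (suc m) l

IsCorner : ∀ {m} → Word (suc m) → Set
IsCorner v = (v ∼ corner l0) ⊎ (v ∼ corner l1) ⊎ (v ∼ corner l2)

C0 C1 C2 : ∀ {m} → EdgeSet m → Set
C0 D = Covered D (corner l0)
C1 D = Covered D (corner l1)
C2 D = Covered D (corner l2)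

Type-f Type-gab Type-gac Type-gbc Type-hab Type-hac Type-hbc Type-t : ∀ {m} → EdgeSet m → Set
Type-f   D = ¬ C0 D × ¬ C1 D × ¬ C2 D
Type-gab D = C0 D × ¬ C1 D × ¬ C2 D
Type-gac D = ¬ C0 D × C1 D × ¬ C2 D
Type-gbc D = ¬ C0 D × ¬ C1 D × C2 D
Type-hab D = ¬ C0 D × C1 D × C2 D
Type-hac D = C0 D × ¬ C1 D × C2 D
Type-hbc D = C0 D × C1 D × ¬ C2 D
Type-t   D = C0 D × C1 D × C2 D

data Parity : Set where
  odd even : Parity

parity : ℕ → Parity
parity zero = even
parity (suc zero) = odd
parity (suc (suc k)) = parity k

IsDimerCovering : ∀ m → EdgeSet m → Set
IsDimerCovering m D =
  IsMatching D ×
  (∀ v → ¬ IsCorner v → Covered D v) ×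
  CornerCond (parity (suc m))
  where
    CornerCond : Parity → Set
    CornerCond odd  = Type-f D ⊎ Type-hab D ⊎ Type-hac D ⊎ Type-hbc D
    CornerCond even = Type-gab D ⊎ Type-gac D ⊎ Type-gbc D ⊎ Type-t D

letters : List Letter
letters = l0 ∷ l1 ∷ l2 ∷ []

allWords : ∀ m → List (Word m)
allWords zero = [] ∷ []
allWords (suc m) = concatMap (λ l → map (l ∷_) (allWords m)) letters

cCount : ∀ {m} → EdgeSet m → ℕ
cCount {m} D = length (filter (λ w → T? (D (w , gc))) (allWords m))

-- mean and variance of c_n (n = suc m), as given: μ_n = 3^(n-1)/4, σ_n² = 3/16
μ : ℕ → ℚ
μ m = (+ (3 ^ m)) / 4

σ² : ℚ
σ² = (+ 3) / 16

dev : ∀ {m} → EdgeSet m → ℚ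
dev {m} D = ((+ cCount D) / 1) - μ m

-- C_n = (c_n − μ_n)/σ_n takes the value  +√k  (resp. −√k)  on D, for k > 0 rational.
-- Since σ_n > 0:  C_n = ±√k  ⇔  ±(c_n − μ_n) > 0  and  (c_n − μ_n)² = k·σ_n².
data Sign : Set where
  plus minus : Sign

C≡_√_ : ∀ {m} → Sign → ℚ → EdgeSet m → Set
(C≡ plus  √ k) D = (0ℚ < dev D) × (dev D * dev D ≡ k * σ²)
(C≡ minus √ k) D = (dev D < 0ℚ) × (dev D * dev D ≡ k * σ²)

module Submission where

-- In Γₙ (n = m + 1) the only contracted edges are the edges
-- l·w — l·σₗ(w) of Σₙ, where σₗ is the generator not incident to l (σ₀ = c,
-- σ₁ = b, σ₂ = a); σₗ is an involution of {0,1,2}ᵐ whose only fixed point is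
-- lᵐ.  So a vertex of Γₙ is a pair {l·w , l·σₗ(w)}, a singleton exactly at
-- the corner lⁿ.  Let occₗ(w) ∈ {0,1} say whether some edge of a dimer
-- covering D ends at the word l·w.  Off the corner, exactly one word of each
-- pair is occupied, so pairing w with σₗ(w) gives
--     2·Σ_w occₗ(w) + 1 = 3ᵐ + 2·eₗ ,      eₗ = [corner lⁿ is covered].
-- Since the edges at a word l·w are distinct edges of one triangle,
-- Σ_w occ₀ = A + B, Σ_w occ₁ = A + C, Σ_w occ₂ = B + C with A, B, C the
-- numbers of a-, b-, c-edges; eliminating A and B yields the balance
--     4·cₙ + 2e₀ + 1 = 3ᵐ + 2(e₁ + e₂),
-- i.e. cₙ − μₙ = (2(e₁ + e₂) − 2e₀ − 1)/4.  Each covering type fixes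
-- (e₀, e₁, e₂), giving cₙ − μₙ ∈ {±3/4, ±1/4}, whose squares are 3σₙ² and σₙ²/3.

open import Defs
open import Data.Nat using (ℕ; zero; suc; _+_; _*_; _^_)
open import Data.Nat.Properties using (+-comm; +-assoc; +-identityʳ; +-cancelˡ-≡)
open import Data.Nat.Tactic.RingSolver using (solve-∀)
open import Data.Vec using ([]; _∷_; replicate; tail)
open import Data.Vec.Properties using (∷-injectiveˡ; ∷-injectiveʳ)
open import Data.List using (List; []; _∷_; _++_; map; length; filter)
open import Data.List.Properties using (length-++; filter-++; ++-identityʳ)
open import Data.Product using (Σ; _×_; _,_; proj₁; proj₂)
open import Data.Sum using (_⊎_; inj₁; inj₂; [_,_])
open import Data.Bool using (Bool; true; false; T; T?; _∨_)
open import Data.Bool.Properties using (T-∨)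
open import Data.Empty using (⊥; ⊥-elim)
open import Data.Integer as ℤ using (ℤ; +_)
import Data.Integer.Properties as ℤP
import Data.Integer.Tactic.RingSolver as ℤSolver
open import Data.Rational as ℚ using (_/_; _-_; 0ℚ; toℚᵘ)
open import Data.Rational.Properties
  using (toℚᵘ-injective; toℚᵘ-homo-+; toℚᵘ-homo‿-; toℚᵘ-fromℚᵘ; positive⁻¹; negative⁻¹)
open import Data.Rational.Unnormalised as ℚᵘ using (mkℚᵘ; *≡*)
import Data.Rational.Unnormalised.Properties as ℚᵘP
open import Function.Bundles using (Equivalence)
open import Relation.Nullary using (¬_)
open import Relation.Binary.PropositionalEquality
  using (_≡_; _≢_; refl; sym; trans; cong; cong₂; subst; module ≡-Reasoning)
open import Relation.Binary.Construct.Closure.ReflexiveTransitive using (ε; _◅_)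
open import Relation.Binary.Construct.Closure.Symmetric using (SymClosure; fwd; bwd)

act-involutive : ∀ s {n} (w : Word n) → act s (act s w) ≡ w
act-involutive s [] = refl
act-involutive ga (l0 ∷ w) = refl
act-involutive ga (l1 ∷ w) = refl
act-involutive ga (l2 ∷ w) = cong (l2 ∷_) (act-involutive ga w)
act-involutive gb (l0 ∷ w) = refl
act-involutive gb (l1 ∷ w) = cong (l1 ∷_) (act-involutive gb w)
act-involutive gb (l2 ∷ w) = refl
act-involutive gc (l0 ∷ w) = cong (l0 ∷_) (act-involutive gc w)
act-involutive gc (l1 ∷ w) = refl
act-involutive gc (l2 ∷ w) = refl

-- The generator whose edge at a word l·w leaves the elementary triangle of w.
opposite : Letter → Gen
opposite l0 = gc
opposite l1 = gb
opposite l2 = ga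

opposite-fixes-constant : ∀ l {k} → act (opposite l) (replicate k l) ≡ replicate k l
opposite-fixes-constant l  {zero}  = refl
opposite-fixes-constant l0 {suc k} = cong (l0 ∷_) (opposite-fixes-constant l0)
opposite-fixes-constant l1 {suc k} = cong (l1 ∷_) (opposite-fixes-constant l1)
opposite-fixes-constant l2 {suc k} = cong (l2 ∷_) (opposite-fixes-constant l2)

opposite-moves : ∀ l {k} (w : Word k) → w ≢ replicate k l → act (opposite l) w ≢ w
opposite-moves l  []       w≢ _ = w≢ refl
opposite-moves l0 (l0 ∷ w) w≢ fixed =
  opposite-moves l0 w (λ eq → w≢ (cong (l0 ∷_) eq)) (∷-injectiveʳ fixed)
opposite-moves l0 (l1 ∷ w) w≢ ()
opposite-moves l0 (l2 ∷ w) w≢ ()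
opposite-moves l1 (l0 ∷ w) w≢ ()
opposite-moves l1 (l1 ∷ w) w≢ fixed =
  opposite-moves l1 w (λ eq → w≢ (cong (l1 ∷_) eq)) (∷-injectiveʳ fixed)
opposite-moves l1 (l2 ∷ w) w≢ ()
opposite-moves l2 (l0 ∷ w) w≢ ()
opposite-moves l2 (l1 ∷ w) w≢ ()
opposite-moves l2 (l2 ∷ w) w≢ fixed =
  opposite-moves l2 w (λ eq → w≢ (cong (l2 ∷_) eq)) (∷-injectiveʳ fixed)

-- The word glued to u in Γₙ: l·w is identified with l·σₗ(w).
partner : ∀ {m} → Word (suc m) → Word (suc m)
partner (l ∷ w) = l ∷ act (opposite l) w

partner-involutive : ∀ {m} (u : Word (suc m)) → partner (partner u) ≡ u
partner-involutive (l ∷ w) = cong (l ∷_) (act-involutive (opposite l) w)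

partner-corner : ∀ {m} l → partner {m} (corner l) ≡ corner l
partner-corner l = cong (l ∷_) (opposite-fixes-constant l)

-- A contracted edge joins a word to its partner: every other edge of Σₙ
-- at l·w lies in the elementary triangle of w.
contracted⇒partner : ∀ {m} {u v : Word (suc m)} → Contracted u v → v ≡ partner u
contracted⇒partner {u = l0 ∷ w} (ga , refl , _ , out) = ⊥-elim (out (w , inj₁ (refl , refl)))
contracted⇒partner {u = l1 ∷ w} (ga , refl , _ , out) = ⊥-elim (out (w , inj₂ (refl , refl)))
contracted⇒partner {u = l2 ∷ w} (ga , refl , _ , _)   = refl
contracted⇒partner {u = l0 ∷ w} (gb , refl , _ , out) = ⊥-elim (out (w , inj₁ (refl , refl)))
contracted⇒partner {u = l1 ∷ w} (gb , refl , _ , _)   = refl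
contracted⇒partner {u = l2 ∷ w} (gb , refl , _ , out) = ⊥-elim (out (w , inj₂ (refl , refl)))
contracted⇒partner {u = l0 ∷ w} (gc , refl , _ , _)   = refl
contracted⇒partner {u = l1 ∷ w} (gc , refl , _ , out) = ⊥-elim (out (w , inj₁ (refl , refl)))
contracted⇒partner {u = l2 ∷ w} (gc , refl , _ , out) = ⊥-elim (out (w , inj₂ (refl , refl)))

∼⇒self-or-partner : ∀ {m} {u v : Word (suc m)} → u ∼ v → v ≡ u ⊎ v ≡ partner u
∼⇒self-or-partner ε = inj₁ refl
∼⇒self-or-partner {u = u} (step ◅ rest) with one-step step | ∼⇒self-or-partner rest
  where
  one-step : ∀ {v} → SymClosure Contracted u v → v ≡ partner u
  one-step (fwd c) = contracted⇒partner c
  one-step (bwd c) = trans (sym (partner-involutive _)) (cong partner (sym (contracted⇒partner c)))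
... | refl | inj₁ refl = inj₂ refl
... | refl | inj₂ refl = inj₁ (partner-involutive u)

∼-partner : ∀ {m} (u : Word (suc m)) → partner u ≢ u → u ∼ partner u
∼-partner (l ∷ w) moved =
  fwd (opposite l , head-action l , (λ eq → moved (sym eq)) , not-in-triangle l) ◅ ε
  where
  head-action : ∀ l → act (opposite l) (l ∷ w) ≡ l ∷ act (opposite l) w
  head-action l0 = refl
  head-action l1 = refl
  head-action l2 = refl
  not-in-triangle : ∀ l → ¬ InElemTriangle (opposite l) (l ∷ w) (l ∷ act (opposite l) w)
  not-in-triangle l0 (_ , inj₁ (() , _))
  not-in-triangle l0 (_ , inj₂ (() , _))
  not-in-triangle l1 (_ , inj₁ (() , _))
  not-in-triangle l1 (_ , inj₂ (() , _))
  not-in-triangle l2 (_ , inj₁ (() , _))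
  not-in-triangle l2 (_ , inj₂ (() , _))

corner-fixed : ∀ {m} {u : Word (suc m)} l → u ∼ corner l → partner u ≡ u
corner-fixed {u = u} l u∼ with ∼⇒self-or-partner u∼
... | inj₁ refl = partner-corner l
... | inj₂ eq = begin
  partner u              ≡⟨ sym eq ⟩
  corner l               ≡⟨ sym (partner-corner l) ⟩
  partner (corner l)     ≡⟨ cong partner eq ⟩
  partner (partner u)    ≡⟨ partner-involutive u ⟩
  u                      ∎
  where open ≡-Reasoning

first second : Letter → Gen
first  l0 = ga
first  l1 = ga
first  l2 = gb
second l0 = gb
second l1 = gc
second l2 = gc

at-first : ∀ {m} l (w : Word m) → IsEndpoint (l ∷ w) (w , first l)
at-first l0 w = inj₁ refl
at-first l1 w = inj₂ refl
at-first l2 w = inj₂ refl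

at-second : ∀ {m} l (w : Word m) → IsEndpoint (l ∷ w) (w , second l)
at-second l0 w = inj₁ refl
at-second l1 w = inj₁ refl
at-second l2 w = inj₂ refl

first≢second : ∀ l → first l ≢ second l
first≢second l0 ()
first≢second l1 ()
first≢second l2 ()

occupied : ∀ {m} → EdgeSet m → Word (suc m) → Bool
occupied D (l ∷ w) = D (w , first l) ∨ D (w , second l)

occupied-sound : ∀ {m} (D : EdgeSet m) e {x} → T (D e) → IsEndpoint x e → T (occupied D x)
occupied-sound D (w , ga) d (inj₁ refl) = Equivalence.from T-∨ (inj₁ d)
occupied-sound D (w , gb) d (inj₁ refl) = Equivalence.from T-∨ (inj₂ d)
occupied-sound D (w , gc) d (inj₁ refl) = Equivalence.from T-∨ (inj₂ d)
occupied-sound D (w , ga) d (inj₂ refl) = Equivalence.from T-∨ (inj₁ d)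
occupied-sound D (w , gb) d (inj₂ refl) = Equivalence.from T-∨ (inj₁ d)
occupied-sound D (w , gc) d (inj₂ refl) = Equivalence.from T-∨ (inj₂ d)

occupied-complete : ∀ {m} (D : EdgeSet m) x → T (occupied D x) →
                    Σ (ElemEdge m) λ e → T (D e) × IsEndpoint x e
occupied-complete D (l ∷ w) occ with Equivalence.to T-∨ occ
... | inj₁ d = (w , first l)  , d , at-first l w
... | inj₂ d = (w , second l) , d , at-second l w

-- A corner of Γₙ is a single word, so it is covered iff that word is occupied.
covered⇒occupied : ∀ {m} (D : EdgeSet m) l → Covered D (corner l) → T (occupied D (corner l))
covered⇒occupied D l (e , d , x , x-end , x∼) with ∼⇒self-or-partner x∼
... | inj₁ refl = occupied-sound D e d x-end
... | inj₂ eq = occupied-sound D e d (subst (λ z → IsEndpoint z e) x≡corner x-end)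
  where
  x≡corner : x ≡ corner l
  x≡corner = trans (sym (partner-involutive x))
                   (trans (cong partner (sym eq)) (partner-corner l))

occupied⇒covered : ∀ {m} (D : EdgeSet m) l → T (occupied D (corner l)) → Covered D (corner l)
occupied⇒covered D l occ with occupied-complete D (corner l) occ
... | e , d , end = e , d , corner l , end , ε

covering-occupies-pair : ∀ {m} (D : EdgeSet m) → (∀ v → ¬ IsCorner v → Covered D v) →
  (u : Word (suc m)) → partner u ≢ u → T (occupied D u) ⊎ T (occupied D (partner u))
covering-occupies-pair D covers u moved with covers u not-corner
  where
  not-corner : ¬ IsCorner u
  not-corner (inj₁ u∼)         = moved (corner-fixed l0 u∼)
  not-corner (inj₂ (inj₁ u∼))  = moved (corner-fixed l1 u∼)
  not-corner (inj₂ (inj₂ u∼))  = moved (corner-fixed l2 u∼)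
... | e , d , x , x-end , x∼u with ∼⇒self-or-partner x∼u
... | inj₁ refl = inj₁ (occupied-sound D e d x-end)
... | inj₂ refl = inj₂ (subst (λ z → T (occupied D z)) (sym (partner-involutive x))
                              (occupied-sound D e d x-end))

-- ... and a matching does not occupy both: the two edges would be distinct
-- (their triangles differ) yet meet in the same vertex of Γₙ.
matching-occupies-one : ∀ {m} (D : EdgeSet m) → IsMatching D →
  (u : Word (suc m)) → partner u ≢ u → T (occupied D u) → T (occupied D (partner u)) → ⊥
matching-occupies-one D (_ , disjoint) (l ∷ w) moved occ occ'
  with occupied-complete D (l ∷ w) occ | occupied-complete D (partner (l ∷ w)) occ'
... | e , d , end | e' , d' , end' =
  disjoint e e' d d' e≢e' (l ∷ w) (partner (l ∷ w)) end end' (∼-partner (l ∷ w) moved)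
  where
  triangle : ∀ {x} (e : ElemEdge _) → IsEndpoint x e → tail x ≡ proj₁ e
  triangle (_ , ga) (inj₁ refl) = refl
  triangle (_ , gb) (inj₁ refl) = refl
  triangle (_ , gc) (inj₁ refl) = refl
  triangle (_ , ga) (inj₂ refl) = refl
  triangle (_ , gb) (inj₂ refl) = refl
  triangle (_ , gc) (inj₂ refl) = refl
  e≢e' : e ≢ e'
  e≢e' refl = moved (cong (l ∷_) (trans (triangle e end') (sym (triangle e end))))

indicator : Bool → ℕ
indicator true  = 1
indicator false = 0

indicator-exactly-one : ∀ a b → T a ⊎ T b → (T a → T b → ⊥) → indicator a + indicator b ≡ 1
indicator-exactly-one true  true  _          both = ⊥-elim (both _ _)
indicator-exactly-one true  false _          _    = refl
indicator-exactly-one false true  _          _    = refl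
indicator-exactly-one false false (inj₁ ())  _
indicator-exactly-one false false (inj₂ ())  _

indicator-∨ : ∀ a b → (T a → T b → ⊥) → indicator (a ∨ b) ≡ indicator a + indicator b
indicator-∨ true  true  both = ⊥-elim (both _ _)
indicator-∨ true  false _    = refl
indicator-∨ false b     _    = refl

letterSum : (Letter → ℕ) → ℕ
letterSum h = h l0 + h l1 + h l2

letterSum-cong : ∀ {h k : Letter → ℕ} → (∀ l → h l ≡ k l) → letterSum h ≡ letterSum k
letterSum-cong h≡k = cong₂ _+_ (cong₂ _+_ (h≡k l0) (h≡k l1)) (h≡k l2)

letterSum-+ : ∀ (h k : Letter → ℕ) → letterSum (λ l → h l + k l) ≡ letterSum h + letterSum k
letterSum-+ h k = interchange (h l0) (k l0) (h l1) (k l1) (h l2) (k l2)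
  where
  interchange : ∀ a a' b b' c c' → a + a' + (b + b') + (c + c') ≡ a + b + c + (a' + b' + c')
  interchange = solve-∀

add-two-blocks : ∀ x N G → x + 1 ≡ N + G → x + 1 + 2 * N ≡ 3 * N + G
add-two-blocks x N G eq = trans (cong (_+ 2 * N) eq) (regroup N G)
  where
  regroup : ∀ N G → N + G + 2 * N ≡ 3 * N + G
  regroup = solve-∀

letterSum-single : ∀ l (h : Letter → ℕ) N G → (∀ l' → l' ≢ l → h l' ≡ N) →
                   h l + 1 ≡ N + G → letterSum h + 1 ≡ 3 * N + G
letterSum-single l0 h N G others special
  rewrite others l1 (λ ()) | others l2 (λ ()) =
  trans (rearrange (h l0) N) (add-two-blocks _ N G special)
  where
  rearrange : ∀ x N → x + N + N + 1 ≡ x + 1 + 2 * N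
  rearrange = solve-∀
letterSum-single l1 h N G others special
  rewrite others l0 (λ ()) | others l2 (λ ()) =
  trans (rearrange (h l1) N) (add-two-blocks _ N G special)
  where
  rearrange : ∀ x N → N + x + N + 1 ≡ x + 1 + 2 * N
  rearrange = solve-∀
letterSum-single l2 h N G others special
  rewrite others l0 (λ ()) | others l1 (λ ()) =
  trans (rearrange (h l2) N) (add-two-blocks _ N G special)
  where
  rearrange : ∀ x N → N + N + x + 1 ≡ x + 1 + 2 * N
  rearrange = solve-∀

total : ∀ m → (Word m → ℕ) → ℕ
total zero    f = f []
total (suc m) f = letterSum (λ l → total m (λ w → f (l ∷ w)))

total-cong : ∀ m {f g : Word m → ℕ} → (∀ w → f w ≡ g w) → total m f ≡ total m g
total-cong zero    f≡g = f≡g []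
total-cong (suc m) f≡g = letterSum-cong (λ l → total-cong m (λ w → f≡g (l ∷ w)))

total-+ : ∀ m (f g : Word m → ℕ) → total m (λ w → f w + g w) ≡ total m f + total m g
total-+ zero    f g = refl
total-+ (suc m) f g =
  trans (letterSum-cong (λ l → total-+ m (λ w → f (l ∷ w)) (λ w → g (l ∷ w))))
        (letterSum-+ (λ l → total m (λ w → f (l ∷ w))) (λ l → total m (λ w → g (l ∷ w))))

total-ones : ∀ m {f : Word m → ℕ} → (∀ w → f w ≡ 1) → total m f ≡ 3 ^ m
total-ones zero    ones = ones []
total-ones (suc m) ones =
  trans (letterSum-cong (λ l → total-ones m (λ w → ones (l ∷ w)))) (triple (3 ^ m))
  where
  triple : ∀ N → N + N + N ≡ 3 * N
  triple = solve-∀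

-- Each generator permutes the words, so it does not change sums.
total-act : ∀ s m (f : Word m → ℕ) → total m (λ w → f (act s w)) ≡ total m f
total-act s zero f = refl
total-act ga (suc m) f rewrite total-act ga m (λ w → f (l2 ∷ w)) =
  cong (_+ total m (λ w → f (l2 ∷ w))) (+-comm (total m (λ w → f (l1 ∷ w))) _)
total-act gb (suc m) f rewrite total-act gb m (λ w → f (l1 ∷ w)) =
  swap-outer (total m (λ w → f (l2 ∷ w))) _ _
  where
  swap-outer : ∀ a b c → a + b + c ≡ c + b + a
  swap-outer = solve-∀
total-act gc (suc m) f rewrite total-act gc m (λ w → f (l0 ∷ w)) =
  swap-last (total m (λ w → f (l0 ∷ w))) _ _
  where
  swap-last : ∀ a b c → a + b + c ≡ a + c + b
  swap-last = solve-∀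

total-except : ∀ m (g : Word m → ℕ) p → (∀ w → w ≢ p → g w ≡ 1) → total m g + 1 ≡ 3 ^ m + g p
total-except zero    g []      _    = +-comm (g []) 1
total-except (suc m) g (l ∷ p) ones =
  letterSum-single l (λ l' → total m (λ w → g (l' ∷ w))) (3 ^ m) (g (l ∷ p)) others special
  where
  others : ∀ l' → l' ≢ l → total m (λ w → g (l' ∷ w)) ≡ 3 ^ m
  others l' l'≢l = total-ones m (λ w → ones (l' ∷ w) (λ eq → l'≢l (∷-injectiveˡ eq)))
  special : total m (λ w → g (l ∷ w)) + 1 ≡ 3 ^ m + g (l ∷ p)
  special = total-except m (λ w → g (l ∷ w)) p (λ w w≢p → ones (l ∷ w) (λ eq → w≢p (∷-injectiveʳ eq)))

pairing : ∀ m l (f : Word m → ℕ) →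
          (∀ w → w ≢ replicate m l → f w + f (act (opposite l) w) ≡ 1) →
          2 * total m f + 1 ≡ 3 ^ m + 2 * f (replicate m l)
pairing m l f complementary = begin
  2 * total m f + 1
    ≡⟨ cong (λ z → total m f + z + 1) (trans (+-identityʳ _) (sym (total-act σ m f))) ⟩
  total m f + total m (λ w → f (act σ w)) + 1
    ≡⟨ cong (_+ 1) (sym (total-+ m f (λ w → f (act σ w)))) ⟩
  total m (λ w → f w + f (act σ w)) + 1
    ≡⟨ total-except m _ p complementary ⟩
  3 ^ m + (f p + f (act σ p))
    ≡⟨ cong (λ z → 3 ^ m + (f p + f z)) (opposite-fixes-constant l) ⟩
  3 ^ m + (f p + f p)
    ≡⟨ cong (λ z → 3 ^ m + (f p + z)) (sym (+-identityʳ (f p))) ⟩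
  3 ^ m + 2 * f p ∎
  where
  open ≡-Reasoning
  σ : Gen
  σ = opposite l
  p : Word m
  p = replicate m l

count : ∀ {A : Set} → (A → Bool) → List A → ℕ
count p xs = length (filter (λ x → T? (p x)) xs)

count-++ : ∀ {A : Set} (p : A → Bool) xs ys → count p (xs ++ ys) ≡ count p xs + count p ys
count-++ p xs ys =
  trans (cong length (filter-++ (λ x → T? (p x)) xs ys)) (length-++ (filter (λ x → T? (p x)) xs))

count-map : ∀ {A B : Set} (p : B → Bool) (h : A → B) xs → count p (map h xs) ≡ count (λ x → p (h x)) xs
count-map p h [] = refl
count-map p h (x ∷ xs) with p (h x)
... | true  = cong suc (count-map p h xs)
... | false = count-map p h xs

count-allWords : ∀ m (p : Word m → Bool) → count p (allWords m) ≡ total m (λ w → indicator (p w))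
count-allWords zero p with p []
... | true  = refl
... | false = refl
count-allWords (suc m) p = begin
  count p (block l0 ++ (block l1 ++ (block l2 ++ [])))
    ≡⟨ count-++ p (block l0) _ ⟩
  count p (block l0) + count p (block l1 ++ (block l2 ++ []))
    ≡⟨ cong (λ z → count p (block l0) + z) (count-++ p (block l1) _) ⟩
  count p (block l0) + (count p (block l1) + count p (block l2 ++ []))
    ≡⟨ cong (λ z → count p (block l0) + (count p (block l1) + count p z)) (++-identityʳ (block l2)) ⟩
  count p (block l0) + (count p (block l1) + count p (block l2))
    ≡⟨ sym (+-assoc (count p (block l0)) _ _) ⟩
  letterSum (λ l → count p (block l))
    ≡⟨ letterSum-cong (λ l → trans (count-map p (l ∷_) (allWords m)) (count-allWords m (λ w → p (l ∷ w)))) ⟩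
  total (suc m) (λ w → indicator (p w)) ∎
  where
  open ≡-Reasoning
  block : Letter → List (Word (suc m))
  block l = map (l ∷_) (allWords m)

cornerCovered : ∀ {m} → EdgeSet m → Letter → ℕ
cornerCovered D l = indicator (occupied D (corner l))

cornerCovered-yes : ∀ {m} (D : EdgeSet m) {l} → Covered D (corner l) → cornerCovered D l ≡ 1
cornerCovered-yes D {l} covered with occupied D (corner l) | covered⇒occupied D l covered
... | true | _ = refl

cornerCovered-no : ∀ {m} (D : EdgeSet m) {l} → ¬ Covered D (corner l) → cornerCovered D l ≡ 0
cornerCovered-no D {l} uncovered with occupied D (corner l) | occupied⇒covered D l
... | false | _   = refl
... | true  | occ = ⊥-elim (uncovered (occ _))

edges : ∀ {m} → EdgeSet m → Gen → ℕ
edges {m} D s = total m (λ w → indicator (D (w , s)))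

occupied-words : ∀ {m} (D : EdgeSet m) → IsDimerCovering m D → ∀ l →
  2 * total m (λ w → indicator (occupied D (l ∷ w))) + 1 ≡ 3 ^ m + 2 * cornerCovered D l
occupied-words {m} D (matching , covers , _) l = pairing m l _ pair-once
  where
  pair-once : ∀ w → w ≢ replicate m l →
    indicator (occupied D (l ∷ w)) + indicator (occupied D (l ∷ act (opposite l) w)) ≡ 1
  pair-once w w≢ = indicator-exactly-one _ _
    (covering-occupies-pair D covers (l ∷ w) moved)
    (matching-occupies-one D matching (l ∷ w) moved)
    where
    moved : partner (l ∷ w) ≢ l ∷ w
    moved eq = opposite-moves l w w≢ (∷-injectiveʳ eq)

-- Counting occupied words l·w through the edges at them: a matching uses
-- at most one of the two (distinct) edges at l·w.
occupied-by-edges : ∀ {m} (D : EdgeSet m) → IsMatching D → ∀ l →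
  total m (λ w → indicator (occupied D (l ∷ w))) ≡ edges D (first l) + edges D (second l)
occupied-by-edges {m} D (_ , disjoint) l =
  trans (total-cong m (λ w → indicator-∨ _ _ (exclusive w)))
        (total-+ m (λ w → indicator (D (w , first l))) (λ w → indicator (D (w , second l))))
  where
  exclusive : ∀ w → T (D (w , first l)) → T (D (w , second l)) → ⊥
  exclusive w d d' = disjoint (w , first l) (w , second l) d d'
    (λ eq → first≢second l (cong proj₂ eq)) (l ∷ w) (l ∷ w) (at-first l w) (at-second l w) ε

eliminate : ∀ A B C N e₀ e₁ e₂ →
  2 * (A + B) + 1 ≡ N + 2 * e₀ → 2 * (A + C) + 1 ≡ N + 2 * e₁ → 2 * (B + C) + 1 ≡ N + 2 * e₂ →
  4 * C + (2 * e₀ + 1) ≡ N + 2 * (e₁ + e₂)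
eliminate A B C N e₀ e₁ e₂ h₀ h₁ h₂ = +-cancelˡ-≡ N _ _ (begin
  N + (4 * C + (2 * e₀ + 1))          ≡⟨ split-corner N C e₀ ⟩
  N + 2 * e₀ + (4 * C + 1)            ≡⟨ cong (_+ (4 * C + 1)) (sym h₀) ⟩
  2 * (A + B) + 1 + (4 * C + 1)       ≡⟨ regroup A B C ⟩
  2 * (A + C) + 1 + (2 * (B + C) + 1) ≡⟨ cong₂ _+_ h₁ h₂ ⟩
  N + 2 * e₁ + (N + 2 * e₂)           ≡⟨ merge N e₁ e₂ ⟩
  N + (N + 2 * (e₁ + e₂))             ∎)
  where
  open ≡-Reasoning
  split-corner : ∀ N C e → N + (4 * C + (2 * e + 1)) ≡ N + 2 * e + (4 * C + 1)
  split-corner = solve-∀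
  regroup : ∀ A B C → 2 * (A + B) + 1 + (4 * C + 1) ≡ 2 * (A + C) + 1 + (2 * (B + C) + 1)
  regroup = solve-∀
  merge : ∀ N e₁ e₂ → N + 2 * e₁ + (N + 2 * e₂) ≡ N + (N + 2 * (e₁ + e₂))
  merge = solve-∀

balance : ∀ {m} (D : EdgeSet m) → IsDimerCovering m D →
  4 * cCount D + (2 * cornerCovered D l0 + 1) ≡ 3 ^ m + 2 * (cornerCovered D l1 + cornerCovered D l2)
balance {m} D dc@(matching , _) = begin
  4 * cCount D + (2 * e₀ + 1)
    ≡⟨ cong (λ c → 4 * c + (2 * e₀ + 1)) (count-allWords m (λ w → D (w , gc))) ⟩
  4 * edges D gc + (2 * e₀ + 1)
    ≡⟨ eliminate (edges D ga) (edges D gb) (edges D gc) (3 ^ m) e₀ e₁ e₂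
                 (by-letter l0) (by-letter l1) (by-letter l2) ⟩
  3 ^ m + 2 * (e₁ + e₂) ∎
  where
  open ≡-Reasoning
  e₀ e₁ e₂ : ℕ
  e₀ = cornerCovered D l0
  e₁ = cornerCovered D l1
  e₂ = cornerCovered D l2
  by-letter : ∀ l → 2 * (edges D (first l) + edges D (second l)) + 1 ≡ 3 ^ m + 2 * cornerCovered D l
  by-letter l = trans (cong (λ t → 2 * t + 1) (sym (occupied-by-edges D matching l)))
                      (occupied-words D dc l)

-- Solving a + x = n + y for a − n in ℤ (written a + (−n)·1, as ℚᵘ subtraction presents it).
subtract-balance : ∀ a x n y → a ℤ.+ x ≡ n ℤ.+ y → a ℤ.+ ℤ.- n ℤ.* + 1 ≡ y ℤ.- x
subtract-balance a x n y balanced = begin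
  a ℤ.+ ℤ.- n ℤ.* + 1     ≡⟨ isolate a x n ⟩
  (a ℤ.+ x) ℤ.- x ℤ.- n   ≡⟨ cong (λ z → z ℤ.- x ℤ.- n) balanced ⟩
  (n ℤ.+ y) ℤ.- x ℤ.- n   ≡⟨ cancel n y x ⟩
  y ℤ.- x                 ∎
  where
  open ≡-Reasoning
  isolate : ∀ a x n → a ℤ.+ ℤ.- n ℤ.* + 1 ≡ (a ℤ.+ x) ℤ.- x ℤ.- n
  isolate = ℤSolver.solve-∀
  cancel : ∀ n y x → (n ℤ.+ y) ℤ.- x ℤ.- n ≡ y ℤ.- x
  cancel = ℤSolver.solve-∀

dev-from-balance : ∀ c N x y → 4 * c + x ≡ N + y → (+ c) / 1 - (+ N) / 4 ≡ (+ y ℤ.- + x) / 4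
dev-from-balance c N x y balanced = toℚᵘ-injective (begin
  toℚᵘ ((+ c) / 1 - (+ N) / 4)
    ≈⟨ toℚᵘ-homo-+ ((+ c) / 1) (ℚ.- ((+ N) / 4)) ⟩
  toℚᵘ ((+ c) / 1) ℚᵘ.+ toℚᵘ (ℚ.- ((+ N) / 4))
    ≈⟨ ℚᵘP.+-cong (toℚᵘ-fromℚᵘ (mkℚᵘ (+ c) 0))
                  (ℚᵘP.≃-trans (toℚᵘ-homo‿- ((+ N) / 4)) (ℚᵘP.-‿cong (toℚᵘ-fromℚᵘ (mkℚᵘ (+ N) 3)))) ⟩
  mkℚᵘ (+ c) 0 ℚᵘ.- mkℚᵘ (+ N) 3
    ≈⟨ *≡* (cong (ℤ._* + 4) (subtract-balance (+ c ℤ.* + 4) (+ x) (+ N) (+ y) balancedℤ)) ⟩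
  mkℚᵘ (+ y ℤ.- + x) 3
    ≈⟨ ℚᵘP.≃-sym (toℚᵘ-fromℚᵘ (mkℚᵘ (+ y ℤ.- + x) 3)) ⟩
  toℚᵘ ((+ y ℤ.- + x) / 4) ∎)
  where
  open ℚᵘP.≃-Reasoning
  balancedℤ : + c ℤ.* + 4 ℤ.+ + x ≡ + N ℤ.+ + y
  balancedℤ = trans (cong (ℤ._+ + x) (trans (ℤP.*-comm (+ c) (+ 4)) (sym (ℤP.pos-* 4 c))))
                    (cong +_ balanced)

excess : ℕ → ℕ → ℕ → ℤ
excess e₀ e₁ e₂ = + (2 * (e₁ + e₂)) ℤ.- + (2 * e₀ + 1)

dev-by-corners : ∀ {m} (D : EdgeSet m) → IsDimerCovering m D → ∀ {e₀ e₁ e₂} →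
  cornerCovered D l0 ≡ e₀ → cornerCovered D l1 ≡ e₁ → cornerCovered D l2 ≡ e₂ →
  dev D ≡ excess e₀ e₁ e₂ / 4
dev-by-corners {m} D dc refl refl refl = dev-from-balance (cCount D) (3 ^ m) _ _ (balance D dc)

C-plus : ∀ {m} (D : EdgeSet m) {q} k → dev D ≡ q → 0ℚ ℚ.< q → q ℚ.* q ≡ k ℚ.* σ² → (C≡ plus √ k) D
C-plus D k refl positive square = positive , square

C-minus : ∀ {m} (D : EdgeSet m) {q} k → dev D ≡ q → q ℚ.< 0ℚ → q ℚ.* q ≡ k ℚ.* σ² → (C≡ minus √ k) D
C-minus D k refl negative square = negative , square

-- The value of C on each covering type: the type fixes (e₀, e₁, e₂), hence
-- cₙ − μₙ = excess e₀ e₁ e₂ / 4 ∈ {±3/4, ±1/4}; sign and square are then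
-- checked by computation on the resulting closed rationals.
module _ {m} (D : EdgeSet m) (dc : IsDimerCovering m D) where

  yes : ∀ {l} → Covered D (corner l) → cornerCovered D l ≡ 1
  yes = cornerCovered-yes D

  no : ∀ {l} → ¬ Covered D (corner l) → cornerCovered D l ≡ 0
  no = cornerCovered-no D

  C-hab : Type-hab D → (C≡ plus √ ((+ 3) / 1)) D
  C-hab (n₀ , c₁ , c₂) = C-plus D ((+ 3) / 1)
    (dev-by-corners D dc (no n₀) (yes c₁) (yes c₂)) (positive⁻¹ _) refl

  C-f : Type-f D → (C≡ minus √ ((+ 1) / 3)) D
  C-f (n₀ , n₁ , n₂) = C-minus D ((+ 1) / 3)
    (dev-by-corners D dc (no n₀) (no n₁) (no n₂)) (negative⁻¹ _) refl

  C-hac : Type-hac D → (C≡ minus √ ((+ 1) / 3)) D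
  C-hac (c₀ , n₁ , c₂) = C-minus D ((+ 1) / 3)
    (dev-by-corners D dc (yes c₀) (no n₁) (yes c₂)) (negative⁻¹ _) refl

  C-hbc : Type-hbc D → (C≡ minus √ ((+ 1) / 3)) D
  C-hbc (c₀ , c₁ , n₂) = C-minus D ((+ 1) / 3)
    (dev-by-corners D dc (yes c₀) (yes c₁) (no n₂)) (negative⁻¹ _) refl

  C-gab : Type-gab D → (C≡ minus √ ((+ 3) / 1)) D
  C-gab (c₀ , n₁ , n₂) = C-minus D ((+ 3) / 1)
    (dev-by-corners D dc (yes c₀) (no n₁) (no n₂)) (negative⁻¹ _) refl

  C-t : Type-t D → (C≡ plus √ ((+ 1) / 3)) D
  C-t (c₀ , c₁ , c₂) = C-plus D ((+ 1) / 3)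
    (dev-by-corners D dc (yes c₀) (yes c₁) (yes c₂)) (positive⁻¹ _) refl

  C-gac : Type-gac D → (C≡ plus √ ((+ 1) / 3)) D
  C-gac (n₀ , c₁ , n₂) = C-plus D ((+ 1) / 3)
    (dev-by-corners D dc (no n₀) (yes c₁) (no n₂)) (positive⁻¹ _) refl

  C-gbc : Type-gbc D → (C≡ plus √ ((+ 1) / 3)) D
  C-gbc (n₀ , n₁ , c₂) = C-plus D ((+ 1) / 3)
    (dev-by-corners D dc (no n₀) (no n₁) (yes c₂)) (positive⁻¹ _) refl

-- Theorem 5.3.  The parity of n only restricts which types occur; the
-- value of C on each type does not depend on it.
theorem5p3 : (m : ℕ) →
    (parity (suc m) ≡ odd →
      ((D : EdgeSet m) → IsDimerCovering m D → Type-hab D → (C≡ plus √ ((+ 3) / 1)) D) ×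
      ((D : EdgeSet m) → IsDimerCovering m D → Type-f D ⊎ Type-hac D ⊎ Type-hbc D →
        (C≡ minus √ ((+ 1) / 3)) D)) ×
    (parity (suc m) ≡ even →
      ((D : EdgeSet m) → IsDimerCovering m D → Type-gab D → (C≡ minus √ ((+ 3) / 1)) D) ×
      ((D : EdgeSet m) → IsDimerCovering m D → Type-t D ⊎ Type-gac D ⊎ Type-gbc D →
        (C≡ plus √ ((+ 1) / 3)) D))
theorem5p3 m =
  (λ _ → C-hab , λ D dc → [ C-f D dc , [ C-hac D dc , C-hbc D dc ] ]) ,
  (λ _ → C-gab , λ D dc → [ C-t D dc , [ C-gac D dc , C-gbc D dc ] ])
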